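{- There is an absolute constant $C>0$ such that for every integer $k\ge1$, every finite connected undirected unweighted graph $G$ whose edge set can be covered by $k$ shortest paths, every vertex $a$ of $G$ and every integer $D$, the number of vertices of $G$ at distance exactly $D$ from $a$ is at most $C\cdot 3^k$. -}

module Defs where

open import Data.Nat using (ℕ; zero; suc; _≤_)
open import Data.Fin using (Fin)
open import Data.Product using (Σ; ∃; _×_; _,_)
open import Data.Sum using (_⊎_)
open import Relation.Binary.PropositionalEquality using (_≡_)
open import Relation.Binary.Definitions using (Symmetric; Irreflexive)

record Graph : Set₁ where
  field
    n      : ℕ
    Adj    : Fin n → Fin n → Set
    sym    : Symmetric Adj
    irrefl : Irreflexive _≡_ Adj

module _ (G : Graph) where
  open Graph G

  Vertex : Set
  Vertex = Fin n

  data Walk : Vertex → Vertex → ℕ → Set where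
    [_]  : (v : Vertex) → Walk v v zero
    _∷_  : ∀ {u v w m} → Adj u v → Walk v w m → Walk u w (suc m)

  data EdgeOn (x y : Vertex) : ∀ {u w m} → Walk u w m → Set where
    here  : ∀ {u v w m} {e : Adj u v} {p : Walk v w m} →
            (u ≡ x × v ≡ y) ⊎ (u ≡ y × v ≡ x) → EdgeOn x y (e ∷ p)
    there : ∀ {u v w m} {e : Adj u v} {p : Walk v w m} →
            EdgeOn x y p → EdgeOn x y (e ∷ p)

  Connected : Set
  Connected = ∀ u v → ∃ λ m → Walk u v m

  Dist : Vertex → Vertex → ℕ → Set
  Dist u v d = Walk u v d × (∀ m → Walk u v m → d ≤ m)

  record ShortestPath : Set where
    field
      start end : Vertex
      len       : ℕ
      walk      : Walk start end len
      shortest  : ∀ m → Walk start end m → len ≤ m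

  CoveredBy : {k : ℕ} → (Fin k → ShortestPath) → Set
  CoveredBy {k} P = ∀ x y → Adj x y →
    Σ (Fin k) λ i → EdgeOn x y (ShortestPath.walk (P i))

-- Cut a shortest walk from a to v into runs: pieces that follow one of the covering paths in
-- one of its two directions.  Since the walk and the covering paths are all geodesic, whenever
-- a decomposition returns to a path it has used before, or enters a path later than another
-- decomposition with the same start does, the runs in between can be replaced by a single run
-- along that path.  So a decomposition with the fewest runs uses each path at most once, and
-- its signature (for each path: unused, forwards or backwards) determines the end vertex, by
-- induction along the runs.  Fewest-run decompositions are reached by descent on the total
-- number of runs, so at most 3^k vertices lie at distance D, i.e. C = 1 works.
module Submission where

open import Defs
open import Data.Bool using (Bool; true; false)
open import Data.Fin using (Fin; zero; suc; _≟_; funToFin; finToFun)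
open import Data.Fin.Properties as Finₚ using (pigeonhole; finToFun-funToFin; suc-injective)
open import Data.List using (List; []; _∷_; _++_; length; map; lookup)
open import Data.List.Membership.Propositional.Properties using (∈-lookup)
open import Data.List.Properties using (map-++; length-++)
open import Data.List.Relation.Unary.All as All using (All)
open import Data.List.Relation.Unary.Unique.Propositional using (Unique)
open import Data.List.Relation.Unary.AllPairs using (_∷_)
open import Data.Maybe using (Maybe; just; nothing)
open import Data.Nat using (ℕ; zero; suc; _+_; _*_; _∸_; _^_; _≤_; _<_; _>_; _≥_; z≤n; s≤s; s<s; _≤?_)
open import Data.Nat.Induction using (<-wellFounded)
open import Data.Nat.ListAction using (sum)
open import Data.Nat.ListAction.Properties using (sum-++)
open import Data.Nat.Properties hiding (_≟_; suc-injective)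
open import Algebra.Properties.CommutativeSemigroup +-commutativeSemigroup using (interchange)
open import Algebra.Properties.Monoid.Sum +-0-monoid using (sum-syntax; sum-cong-≗)
open import Data.Product using (Σ; _×_; _,_; proj₁; proj₂)
open import Data.Sum as Sum using (_⊎_; inj₁; inj₂)
open import Data.Unit using (⊤; tt)
open import Function using (_∘_)
open import Induction.WellFounded using (Acc; acc)
open import Relation.Binary.Definitions using (tri<; tri≈; tri>)
open import Relation.Binary.PropositionalEquality
open import Relation.Nullary using (yes; no; contradiction)

∑-< : ∀ {n} (f g : Fin n → ℕ) i → (∀ j → j ≢ i → f j ≡ g j) → f i < g i → ∑[ j < n ] f j < ∑[ j < n ] g j
∑-< f g zero    same lt = +-mono-<-≤ lt (≤-reflexive (sum-cong-≗ (λ j → same (suc j) λ ())))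
∑-< f g (suc i) same lt = +-mono-≤-< (≤-reflexive (same zero λ ()))
  (∑-< (f ∘ suc) (g ∘ suc) i (λ j j≢i → same (suc j) (j≢i ∘ suc-injective)) lt)

length-<-++-∷ : ∀ {A : Set} (pre : List A) x post → length post < length (pre ++ x ∷ post)
length-<-++-∷ pre x post = ≤-trans (m≤n+m _ (length pre)) (≤-reflexive (sym (length-++ pre)))

lookup-injective : ∀ {A : Set} {xs : List A} → Unique xs → ∀ {i j} → lookup xs i ≡ lookup xs j → i ≡ j
lookup-injective (_  ∷ _)  {zero}  {zero}  _  = refl
lookup-injective (x∉ ∷ _)  {zero}  {suc j} eq = contradiction eq (All.lookup x∉ (∈-lookup j))
lookup-injective (x∉ ∷ _)  {suc i} {zero}  eq = contradiction (sym eq) (All.lookup x∉ (∈-lookup i))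
lookup-injective (_  ∷ xs) {suc i} {suc j} eq = cong suc (lookup-injective xs eq)

encode : Maybe Bool → Fin 3
encode nothing      = zero
encode (just false) = suc zero
encode (just true)  = suc (suc zero)

decode : Fin 3 → Maybe Bool
decode zero             = nothing
decode (suc zero)       = just false
decode (suc (suc zero)) = just true

decode-encode : ∀ x → decode (encode x) ≡ x
decode-encode nothing      = refl
decode-encode (just false) = refl
decode-encode (just true)  = refl

code : ∀ {k} → (Fin k → Maybe Bool) → Fin (3 ^ k)
code s = funToFin (encode ∘ s)

code-injective : ∀ {k} (s t : Fin k → Maybe Bool) → code s ≡ code t → ∀ i → s i ≡ t i
code-injective s t eq i = begin
  s i                                ≡⟨ decode-encode (s i) ⟨
  decode (encode (s i))              ≡⟨ cong decode (finToFun-funToFin (encode ∘ s) i) ⟨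
  decode (finToFun (code s) i)       ≡⟨ cong (λ c → decode (finToFun c i)) eq ⟩
  decode (finToFun (code t) i)       ≡⟨ cong decode (finToFun-funToFin (encode ∘ t) i) ⟩
  decode (encode (t i))              ≡⟨ decode-encode (t i) ⟩
  t i                                ∎
  where open ≡-Reasoning

m<m+n⇒0<n : ∀ {m n} → m < m + n → 0 < n
m<m+n⇒0<n {m} lt = +-cancelˡ-< m 0 _ (subst (_< m + _) (sym (+-identityʳ m)) lt)

∸-shift : ∀ {n} x d → x + d ≤ n → n ∸ (x + d) + d ≡ n ∸ x
∸-shift {n} x d x+d≤ = begin
  n ∸ (x + d) + d   ≡⟨ cong (_+ d) (∸-+-assoc n x d) ⟨
  n ∸ x ∸ d + d     ≡⟨ m∸n+n≡m (m+n≤o⇒m≤o∸n d (subst (_≤ n) (+-comm x d) x+d≤)) ⟩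
  n ∸ x             ∎
  where open ≡-Reasoning

module Walks (G : Graph) where
  open Graph G using (Adj) renaming (sym to Adj-sym)

  infixr 5 _++ʷ_

  _++ʷ_ : ∀ {u v w m m′} → Walk G u v m → Walk G v w m′ → Walk G u w (m + m′)
  [ _ ]   ++ʷ q = q
  (e ∷ p) ++ʷ q = e ∷ (p ++ʷ q)

  _∷ʳ_ : ∀ {u v w m} → Walk G u v m → Adj v w → Walk G u w (suc m)
  [ _ ]    ∷ʳ e = e ∷ [ _ ]
  (e′ ∷ p) ∷ʳ e = e′ ∷ (p ∷ʳ e)

  reverse : ∀ {u v m} → Walk G u v m → Walk G v u m
  reverse [ v ]   = [ v ]
  reverse (e ∷ p) = reverse p ∷ʳ Adj-sym e

  Dist≥ : Vertex G → Vertex G → ℕ → Set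
  Dist≥ u v d = ∀ m → Walk G u v m → d ≤ m

  Dist≥-drop : ∀ {u w v d d′} → Dist≥ u v (d + d′) → Walk G u w d → Dist≥ w v d′
  Dist≥-drop {d = d} dist p m q = +-cancelˡ-≤ d _ _ (dist (d + m) (p ++ʷ q))

  Dist≥-take : ∀ {u w v d d′} → Dist≥ u v (d + d′) → Walk G w v d′ → Dist≥ u w d
  Dist≥-take {d′ = d′} dist q m p = +-cancelʳ-≤ d′ _ _ (dist (m + d′) (p ++ʷ q))

  at : ∀ {u w m} → Walk G u w m → ℕ → Vertex G
  at {u} _ zero    = u
  at [ v ]   (suc t) = v
  at (e ∷ p) (suc t) = at p t

  at-end : ∀ {u w m} (p : Walk G u w m) → at p m ≡ w
  at-end [ v ]   = refl
  at-end (e ∷ p) = at-end p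

  subwalk : ∀ {u w m} (p : Walk G u w m) x d → x + d ≤ m → Walk G (at p x) (at p (x + d)) d
  subwalk p       zero    zero    _        = [ _ ]
  subwalk (e ∷ p) zero    (suc d) (s≤s le) = e ∷ subwalk p zero d le
  subwalk (e ∷ p) (suc x) d       (s≤s le) = subwalk p x d le

  edge-index : ∀ {u w m x y} (p : Walk G u w m) → EdgeOn G x y p →
    Σ ℕ λ t → t + 1 ≤ m × ((at p t ≡ x × at p (t + 1) ≡ y) ⊎ (at p t ≡ y × at p (t + 1) ≡ x))
  edge-index (e ∷ p) (here side) = 0 , s≤s z≤n , side
  edge-index (e ∷ p) (there on) with t , t+1≤ , side ← edge-index p on = suc t , s≤s t+1≤ , side

  record Line : Set where
    field
      len      : ℕ
      pt       : ℕ → Vertex G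
      segment  : ∀ x d → x + d ≤ len → Walk G (pt x) (pt (x + d)) d
      progress : ∀ {x y m} → x ≤ len → y ≤ len → Walk G (pt x) (pt y) m → y ≤ x + m

  pathLine : ShortestPath G → Line
  pathLine P = record { len = len ; pt = at walk ; segment = subwalk walk ; progress = progress }
    where
    open ShortestPath P
    progress : ∀ {x y m} → x ≤ len → y ≤ len → Walk G (at walk x) (at walk y) m → y ≤ x + m
    progress {x} {y} {m} x≤ y≤ q = +-cancelʳ-≤ (len ∸ y) y (x + m) (begin
      y + (len ∸ y)           ≡⟨ m+[n∸m]≡n y≤ ⟩
      len                     ≤⟨ shortest _ (subwalk walk 0 x x≤ ++ʷ q ++ʷ toEnd) ⟩
      x + (m + (len ∸ y))     ≡⟨ +-assoc x m _ ⟨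
      x + m + (len ∸ y)       ∎)
      where
      open ≤-Reasoning
      toEnd : Walk G (at walk y) end (len ∸ y)
      toEnd = subst (λ w → Walk G (at walk y) w (len ∸ y)) (trans (cong (at walk) (m+[n∸m]≡n y≤)) (at-end walk))
                (subwalk walk y (len ∸ y) (≤-reflexive (m+[n∸m]≡n y≤)))

  reverseLine : Line → Line
  reverseLine ℒ = record { len = len ; pt = λ x → pt (len ∸ x) ; segment = segment′ ; progress = progress′ }
    where
    open Line ℒ
    segment′ : ∀ x d → x + d ≤ len → Walk G (pt (len ∸ x)) (pt (len ∸ (x + d))) d
    segment′ x d x+d≤ = subst (λ y → Walk G (pt y) (pt (len ∸ (x + d))) d) (∸-shift x d x+d≤)
      (reverse (segment (len ∸ (x + d)) d (≤-trans (≤-reflexive (∸-shift x d x+d≤)) (m∸n≤m len x))))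
    progress′ : ∀ {x y m} → x ≤ len → y ≤ len → Walk G (pt (len ∸ x)) (pt (len ∸ y)) m → y ≤ x + m
    progress′ {x} {y} {m} x≤ y≤ q = subst (y ≤_) (+-comm m x) (+-cancelˡ-≤ (len ∸ y) y (m + x) (begin
      len ∸ y + y             ≡⟨ m∸n+n≡m y≤ ⟩
      len                     ≡⟨ m∸n+n≡m x≤ ⟨
      len ∸ x + x             ≤⟨ +-monoˡ-≤ x (progress (m∸n≤m len y) (m∸n≤m len x) (reverse q)) ⟩
      len ∸ y + m + x         ≡⟨ +-assoc (len ∸ y) m x ⟩
      len ∸ y + (m + x)       ∎))
      where open ≤-Reasoning

  reverseLine-pt : ∀ ℒ {x} → x ≤ Line.len ℒ → Line.pt (reverseLine ℒ) (Line.len ℒ ∸ x) ≡ Line.pt ℒ x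
  reverseLine-pt ℒ x≤ = cong (Line.pt ℒ) (m∸[m∸n]≡n x≤)

  module _ (ℒ : Line) where
    open Line ℒ

    -- Running ahead contradicts progress; lagging behind would make the route along the line
    -- from pt p to pt (p′ + ℓ) shorter than m + ℓ.
    align : ∀ {p p′ ℓ m} → p ≤ len → p′ + ℓ ≤ len → 1 ≤ ℓ → Walk G (pt p) (pt p′) m →
            Dist≥ (pt p) (pt (p′ + ℓ)) (m + ℓ) → p′ ≡ p + m
    align {p} {p′} {ℓ} {m} p≤ q≤ 1≤ℓ w dist = ≤-antisym (progress p≤ p′≤ w) ahead
      where
      open ≤-Reasoning
      p′≤ : p′ ≤ len
      p′≤ = m+n≤o⇒m≤o p′ q≤
      ahead : p + m ≤ p′
      ahead with ≤-total p (p′ + ℓ)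
      ... | inj₁ p≤q = +-cancelʳ-≤ ℓ _ _ (begin
        p + m + ℓ      ≡⟨ +-assoc p m ℓ ⟩
        p + (m + ℓ)    ≤⟨ +-monoʳ-≤ p (dist d forward) ⟩
        p + d          ≡⟨ p+d ⟩
        p′ + ℓ         ∎)
        where
        d = p′ + ℓ ∸ p
        p+d : p + d ≡ p′ + ℓ
        p+d = m+[n∸m]≡n p≤q
        forward : Walk G (pt p) (pt (p′ + ℓ)) d
        forward = subst (λ y → Walk G (pt p) (pt y) d) p+d (segment p d (subst (_≤ len) (sym p+d) q≤))
      ... | inj₂ q≤p = contradiction overshoot (<⇒≱ (m<m+n (p′ + m) (≤-trans 1≤ℓ (m≤m+n ℓ ℓ))))
        where
        d = p ∸ (p′ + ℓ)
        q+d : p′ + ℓ + d ≡ p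
        q+d = m+[n∸m]≡n q≤p
        backward : Walk G (pt p) (pt (p′ + ℓ)) d
        backward = subst (λ y → Walk G (pt y) (pt (p′ + ℓ)) d) q+d
                     (reverse (segment (p′ + ℓ) d (subst (_≤ len) (sym q+d) p≤)))
        overshoot : p′ + m + (ℓ + ℓ) ≤ p′ + m
        overshoot = begin
          p′ + m + (ℓ + ℓ)      ≡⟨ interchange p′ m ℓ ℓ ⟩
          p′ + ℓ + (m + ℓ)      ≤⟨ +-monoʳ-≤ (p′ + ℓ) (dist d backward) ⟩
          p′ + ℓ + d            ≡⟨ q+d ⟩
          p                     ≤⟨ progress p′≤ p≤ (reverse w) ⟩
          p′ + m                ∎

module Runs (G : Graph) {k : ℕ} (P : Fin k → ShortestPath G) where
  open Walks G

  Track : Set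
  Track = Fin k × Bool

  line : Track → Line
  line (i , true)  = pathLine (P i)
  line (i , false) = reverseLine (pathLine (P i))

  len : Track → ℕ
  len o = Line.len (line o)

  pt : Track → ℕ → Vertex G
  pt o = Line.pt (line o)

  segment : ∀ o x d → x + d ≤ len o → Walk G (pt o x) (pt o (x + d)) d
  segment o = Line.segment (line o)

  reorient : ∀ i d d′ {x} → x ≤ len (i , d) → Σ ℕ λ y → y ≤ len (i , d′) × pt (i , d′) y ≡ pt (i , d) x
  reorient i true  true  x≤ = _ , x≤ , refl
  reorient i false false x≤ = _ , x≤ , refl
  reorient i true  false {x} x≤ = len (i , true) ∸ x , m∸n≤m _ x , reverseLine-pt (pathLine (P i)) x≤
  reorient i false true  {x} x≤ = len (i , true) ∸ x , m∸n≤m _ x , refl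

  record Run : Set where
    constructor run
    field
      track     : Track
      pos steps : ℕ
  open Run

  end : Run → Vertex G
  end (run o p ℓ) = pt o (p + ℓ)

  Valid : Vertex G → List Run → Vertex G → Set
  Valid b []               v = b ≡ v
  Valid b (run o p ℓ ∷ rs) v = 1 ≤ ℓ × p + ℓ ≤ len o × pt o p ≡ b × Valid (pt o (p + ℓ)) rs v

  total : List Run → ℕ
  total rs = sum (map steps rs)

  total-++ : ∀ pre rs → total (pre ++ rs) ≡ total pre + total rs
  total-++ pre rs = trans (cong sum (map-++ steps pre rs)) (sum-++ (map steps pre) (map steps rs))

  toWalk : ∀ {b v} rs → Valid b rs v → Walk G b v (total rs)
  toWalk []               refl                = [ _ ]
  toWalk (run o p ℓ ∷ rs) (_ , ℓ≤ , refl , valid) = segment o p ℓ ℓ≤ ++ʷ toWalk rs valid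

  Valid-++⁻ : ∀ {b v} pre rs → Valid b (pre ++ rs) v → Σ (Vertex G) λ z → Valid b pre z × Valid z rs v
  Valid-++⁻ []                rs valid = _ , refl , valid
  Valid-++⁻ (run o p ℓ ∷ pre) rs (1≤ℓ , ℓ≤ , eq , valid) with z , vpre , vrs ← Valid-++⁻ pre rs valid
    = z , (1≤ℓ , ℓ≤ , eq , vpre) , vrs

  record Geodesic (b : Vertex G) (rs : List Run) (v : Vertex G) : Set where
    constructor geodesic
    field
      valid    : Valid b rs v
      shortest : Dist≥ b v (total rs)

  Geodesic-tail : ∀ {b v} r rs → Geodesic b (r ∷ rs) v → Geodesic (end r) rs v
  Geodesic-tail (run o p ℓ) rs (geodesic (_ , ℓ≤ , refl , valid) dist) =
    geodesic valid (Dist≥-drop dist (segment o p ℓ ℓ≤))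

  record Better (b v : Vertex G) (rs : List Run) : Set where
    constructor better
    field
      runs    : List Run
      valid   : Valid b runs v
      total≡  : total runs ≡ total rs
      shorter : length runs < length rs

  Better-∷ : ∀ {b v} r rs → Valid b (r ∷ rs) v → Better (end r) v rs → Better b v (r ∷ rs)
  Better-∷ (run o p ℓ) rs (1≤ℓ , ℓ≤ , eq , _) (better rs′ valid tot shorter) =
    better (run o p ℓ ∷ rs′) (1≤ℓ , ℓ≤ , eq , valid) (cong (ℓ +_) tot) (s<s shorter)

  Better-resp : ∀ {b v rs rs′} → total rs ≡ total rs′ → length rs ≡ length rs′ → Better b v rs → Better b v rs′
  Better-resp tot len (better rs″ valid tot″ shorter) =
    better rs″ valid (trans tot″ tot) (subst (length rs″ <_) len shorter)

  module _ {o : Track} {p : ℕ} {b v : Vertex G} (pt≡ : pt o p ≡ b) (p≤ : p ≤ len o) where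

    aligned : ∀ pre {p′ ℓ′} post → Geodesic b (pre ++ run o p′ ℓ′ ∷ post) v → p′ ≡ p + total pre
    aligned pre {p′} {ℓ′} post (geodesic valid dist)
      with z , vpre , (1≤ℓ′ , q≤ , refl , vpost) ← Valid-++⁻ pre (run o p′ ℓ′ ∷ post) valid
      rewrite sym pt≡
      = align (line o) p≤ q≤ 1≤ℓ′ (toWalk pre vpre)
          (Dist≥-take (subst (Dist≥ (pt o p) v) reassoc dist) (toWalk post vpost))
      where
      reassoc : total (pre ++ run o p′ ℓ′ ∷ post) ≡ total pre + ℓ′ + total post
      reassoc = trans (total-++ pre _) (sym (+-assoc (total pre) ℓ′ (total post)))

    merge : ∀ pre {p′ ℓ′} post → Geodesic b (pre ++ run o p′ ℓ′ ∷ post) v →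
            Valid b (run o p (total pre + ℓ′) ∷ post) v
    merge pre {p′} {ℓ′} post geo@(geodesic valid _)
      with refl ← aligned pre post geo
      with _ , _ , (1≤ℓ′ , q≤ , _ , vpost) ← Valid-++⁻ pre (run o p′ ℓ′ ∷ post) valid
      = ≤-trans 1≤ℓ′ (m≤n+m ℓ′ _) , subst (_≤ len o) (+-assoc p _ ℓ′) q≤ , pt≡ ,
        subst (λ x → Valid (pt o x) post v) (+-assoc p _ ℓ′) vpost

  total-merge : ∀ {o p} pre {p′ ℓ′} post →
                total (run o p (total pre + ℓ′) ∷ post) ≡ total (pre ++ run o p′ ℓ′ ∷ post)
  total-merge pre {ℓ′ = ℓ′} post = trans (+-assoc (total pre) ℓ′ (total post)) (sym (total-++ pre _))

  merge-better : ∀ {o p b v} r pre {p′ ℓ′} post → pt o p ≡ b → p ≤ len o →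
                 Geodesic b (r ∷ pre ++ run o p′ ℓ′ ∷ post) v → Better b v (r ∷ pre ++ run o p′ ℓ′ ∷ post)
  merge-better {o} {p} r pre {p′} {ℓ′} post pt≡ p≤ geo =
    better (run o p (total (r ∷ pre) + ℓ′) ∷ post) (merge pt≡ p≤ (r ∷ pre) post geo)
           (total-merge {o} {p} (r ∷ pre) {p′} post) (s<s (length-<-++-∷ pre (run o p′ ℓ′) post))

  -- sig rs i is the orientation in which rs first runs along the i-th covering path.
  Signature : Set
  Signature = Fin k → Maybe Bool

  use : Track → Signature → Signature
  use (i , d) s j with j ≟ i
  ... | yes _ = just d
  ... | no  _ = s j

  sig : List Run → Signature
  sig []       _ = nothing
  sig (r ∷ rs)   = use (track r) (sig rs)

  use-here : ∀ o s → use o s (proj₁ o) ≡ just (proj₂ o)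
  use-here (i , d) s with i ≟ i
  ... | yes _  = refl
  ... | no i≢i = contradiction refl i≢i

  use-there : ∀ o s {j} → j ≢ proj₁ o → use o s j ≡ s j
  use-there (i , d) s {j} j≢i with j ≟ i
  ... | yes j≡i = contradiction j≡i j≢i
  ... | no  _   = refl

  use-cancel : ∀ o s s′ → use o s ≗ use o s′ → s (proj₁ o) ≡ nothing → s′ (proj₁ o) ≡ nothing → s ≗ s′
  use-cancel (i , d) s s′ eq fresh fresh′ j with j ≟ i
  ... | yes refl = trans fresh (sym fresh′)
  ... | no  j≢i  = trans (sym (use-there (i , d) s j≢i)) (trans (eq j) (use-there (i , d) s′ j≢i))

  locate : ∀ rs {i d} → sig rs i ≡ just d →
           Σ (List Run) λ pre → Σ ℕ λ p → Σ ℕ λ ℓ → Σ (List Run) λ post → rs ≡ pre ++ run (i , d) p ℓ ∷ post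
  locate (run (i′ , d′) p ℓ ∷ rs) {i} eq with i ≟ i′
  ... | yes refl with refl ← eq = [] , p , ℓ , rs , refl
  ... | no _ with pre , p′ , ℓ′ , post , refl ← locate rs eq = run (i′ , d′) p ℓ ∷ pre , p′ , ℓ′ , post , refl

  Normal : List Run → Set
  Normal []       = ⊤
  Normal (r ∷ rs) = sig rs (proj₁ (track r)) ≡ nothing × Normal rs

  revisit-better : ∀ {b v} r pre {d p′ ℓ′} post →
    Geodesic b (r ∷ pre ++ run (proj₁ (track r) , d) p′ ℓ′ ∷ post) v →
    Better b v (r ∷ pre ++ run (proj₁ (track r) , d) p′ ℓ′ ∷ post)
  revisit-better (run (i , d₀) p ℓ) pre {d} post geo@(geodesic (_ , ℓ≤ , pt≡ , _) _)
    with q , q≤ , ptq ← reorient i d₀ d (m+n≤o⇒m≤o p ℓ≤)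
    = merge-better {i , d} {q} (run (i , d₀) p ℓ) pre post (trans ptq pt≡) q≤ geo

  normalise : ∀ {b v} rs → Geodesic b rs v → Normal rs ⊎ Better b v rs
  normalise []       _   = inj₁ tt
  normalise (r ∷ rs) geo with sig rs (proj₁ (track r)) in eq
  ... | just d with pre , p′ , ℓ′ , post , refl ← locate rs eq = inj₂ (revisit-better r pre post geo)
  ... | nothing with normalise rs (Geodesic-tail r rs geo)
  ...   | inj₁ normal = inj₁ (refl , normal)
  ...   | inj₂ improved = inj₂ (Better-∷ r rs (Geodesic.valid geo) improved)

  Outcome : Vertex G → Vertex G → List Run → Vertex G → List Run → Set
  Outcome b u rs v rs′ = u ≡ v ⊎ Better b u rs ⊎ Better b v rs′

  Outcome-∷ : ∀ {b u v} r rs rs′ → Valid b (r ∷ rs) u → Valid b (r ∷ rs′) v →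
              Outcome (end r) u rs v rs′ → Outcome b u (r ∷ rs) v (r ∷ rs′)
  Outcome-∷ r rs rs′ valid valid′ = Sum.map₂ (Sum.map (Better-∷ r rs valid) (Better-∷ r rs′ valid′))

  Outcome-respˡ : ∀ {b u v rs rs″ rs′} → total rs″ ≡ total rs → length rs″ ≡ length rs →
                  Outcome b u rs″ v rs′ → Outcome b u rs v rs′
  Outcome-respˡ tot len = Sum.map₂ (Sum.map₁ (Better-resp tot len))

  Outcome-respʳ : ∀ {b u v rs rs′ rs″} → total rs″ ≡ total rs′ → length rs″ ≡ length rs′ →
                  Outcome b u rs v rs″ → Outcome b u rs v rs′
  Outcome-respʳ tot len = Sum.map₂ (Sum.map₂ (Better-resp tot len))

  NormalGeodesic : Vertex G → List Run → Vertex G → Set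
  NormalGeodesic b rs v = Geodesic b rs v × Normal rs

  SigInjective : ℕ → Set
  SigInjective n = ∀ {b u v} rs rs′ → length rs ≤ n → length rs′ ≤ n →
           NormalGeodesic b rs u → NormalGeodesic b rs′ v →
           total rs ≡ total rs′ → sig rs ≗ sig rs′ → Outcome b u rs v rs′

  same-head : ∀ {n} → SigInjective n → ∀ {b u v} r rest post → length rest ≤ n → length post ≤ n →
    NormalGeodesic b (r ∷ rest) u → NormalGeodesic b (r ∷ post) v →
    total (r ∷ rest) ≡ total (r ∷ post) → sig (r ∷ rest) ≗ sig (r ∷ post) →
    Outcome b u (r ∷ rest) v (r ∷ post)
  same-head rec r rest post ≤n ≤n′ (geo , fresh , normal) (geo′ , fresh′ , normal′) tot sigs =
    Outcome-∷ r rest post (Geodesic.valid geo) (Geodesic.valid geo′)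
      (rec rest post ≤n ≤n′ (Geodesic-tail r rest geo , normal) (Geodesic-tail r post geo′ , normal′)
        (+-cancelˡ-≡ (steps r) _ _ tot) (use-cancel (track r) _ _ sigs fresh fresh′))

  -- Splitting the first run after ℓ steps, the rest of it can be merged into the next run along oQ.
  retrack : ∀ {v o p ℓ e oQ s} pre {s′ ℓQ′} post → 1 ≤ ℓ → 1 ≤ e → pt oQ s ≡ pt o (p + ℓ) → s ≤ len oQ →
    Geodesic (pt o p) (run o p (ℓ + e) ∷ pre ++ run oQ s′ ℓQ′ ∷ post) v →
    Geodesic (pt o p) (run o p ℓ ∷ run oQ s (e + total pre + ℓQ′) ∷ post) v ×
    total (run o p ℓ ∷ run oQ s (e + total pre + ℓQ′) ∷ post) ≡
    total (run o p (ℓ + e) ∷ pre ++ run oQ s′ ℓQ′ ∷ post)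
  retrack {v} {o} {p} {ℓ} {e} {oQ} {s} pre {s′} {ℓQ′} post 1≤ℓ 1≤e ptQ s≤
          (geodesic (_ , ℓe≤ , _ , valid) dist) =
    geodesic (1≤ℓ , ℓ≤ , refl , merge ptQ s≤ (run o (p + ℓ) e ∷ pre) post (Geodesic-tail (run o p ℓ) _ split))
             (subst (Dist≥ (pt o p) v) (sym tot) dist) ,
    tot
    where
    p+ℓ+e≡ : p + ℓ + e ≡ p + (ℓ + e)
    p+ℓ+e≡ = +-assoc p ℓ e
    ℓ≤ : p + ℓ ≤ len o
    ℓ≤ = m+n≤o⇒m≤o (p + ℓ) (subst (_≤ len o) (sym p+ℓ+e≡) ℓe≤)
    split : Geodesic (pt o p) (run o p ℓ ∷ run o (p + ℓ) e ∷ pre ++ run oQ s′ ℓQ′ ∷ post) v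
    split = geodesic (1≤ℓ , ℓ≤ , refl , 1≤e , subst (_≤ len o) (sym p+ℓ+e≡) ℓe≤ , refl ,
                      subst (λ x → Valid (pt o x) (pre ++ run oQ s′ ℓQ′ ∷ post) v) (sym p+ℓ+e≡) valid)
                     (subst (Dist≥ (pt o p) v) (+-assoc ℓ e _) dist)
    tot : total (run o p ℓ ∷ run oQ s (e + total pre + ℓQ′) ∷ post) ≡
          total (run o p (ℓ + e) ∷ pre ++ run oQ s′ ℓQ′ ∷ post)
    tot = trans (cong (ℓ +_) (total-merge {oQ} {s} (run o (p + ℓ) e ∷ pre) {s′} post)) (sym (+-assoc ℓ e _))

  uses-next : ∀ o oQ s t → use o (use oQ s) ≗ use o t → use oQ s (proj₁ o) ≡ nothing →
              t (proj₁ oQ) ≡ just (proj₂ oQ)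
  uses-next o oQ s t sigs fresh = begin
    t (proj₁ oQ)                  ≡⟨ use-there o t distinct ⟨
    use o t (proj₁ oQ)            ≡⟨ sigs (proj₁ oQ) ⟨
    use o (use oQ s) (proj₁ oQ)   ≡⟨ use-there o _ distinct ⟩
    use oQ s (proj₁ oQ)           ≡⟨ use-here oQ s ⟩
    just (proj₂ oQ)               ∎
    where
    open ≡-Reasoning
    distinct : proj₁ oQ ≢ proj₁ o
    distinct refl with () ← trans (sym (use-here oQ s)) fresh

  trim-head : ∀ {b u v o p ℓ e} rest post → 1 ≤ e →
    NormalGeodesic b (run o p ℓ ∷ rest) u → NormalGeodesic b (run o p (ℓ + e) ∷ post) v →
    total (run o p ℓ ∷ rest) ≡ total (run o p (ℓ + e) ∷ post) →
    sig (run o p ℓ ∷ rest) ≗ sig (run o p (ℓ + e) ∷ post) →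
    Better b v (run o p (ℓ + e) ∷ post) ⊎
    Σ (List Run) λ post′ → NormalGeodesic b (run o p ℓ ∷ post′) v × length post′ ≡ length post ×
      total (run o p ℓ ∷ post′) ≡ total (run o p (ℓ + e) ∷ post) ×
      sig (run o p ℓ ∷ post′) ≗ sig (run o p (ℓ + e) ∷ post)
  trim-head {ℓ = ℓ} {e} [] post 1≤e _ _ tot _ =
    contradiction tot (<⇒≢ (≤-trans (+-monoʳ-< ℓ 1≤e) (m≤m+n (ℓ + e) (total post))))
  trim-head {o = o} {p} {ℓ} {e} (run oQ s ℓQ ∷ rest) post 1≤e
    (geodesic (1≤ℓ , _ , refl , _ , sℓQ≤ , ptQ , _) _ , fresh , _) (geo′ , fresh′ , normal′) tot sigs
    with locate post (uses-next o oQ (sig rest) (sig post) sigs fresh)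
  ... | [] , s′ , ℓQ′ , post₂ , refl
    with geo″ , tot″ ← retrack [] post₂ 1≤ℓ 1≤e ptQ (m+n≤o⇒m≤o s sℓQ≤) geo′
    = inj₂ (_ , (geo″ , fresh′ , normal′) , refl , tot″ , λ _ → refl)
  ... | r ∷ pre₂ , s′ , ℓQ′ , post₂ , refl
    with geo″ , tot″ ← retrack (r ∷ pre₂) post₂ 1≤ℓ 1≤e ptQ (m+n≤o⇒m≤o s sℓQ≤) geo′
    = inj₁ (better (run o p ℓ ∷ run oQ s (e + total (r ∷ pre₂) + ℓQ′) ∷ post₂) (Geodesic.valid geo″) tot″
                   (s<s (s<s (length-<-++-∷ pre₂ (run oQ s′ ℓQ′) post₂))))

  longer-headʳ : ∀ {n} → SigInjective n → ∀ {b u v o p ℓ e} rest post → 1 ≤ e →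
    length rest ≤ n → length post ≤ n →
    NormalGeodesic b (run o p ℓ ∷ rest) u → NormalGeodesic b (run o p (ℓ + e) ∷ post) v →
    total (run o p ℓ ∷ rest) ≡ total (run o p (ℓ + e) ∷ post) →
    sig (run o p ℓ ∷ rest) ≗ sig (run o p (ℓ + e) ∷ post) →
    Outcome b u (run o p ℓ ∷ rest) v (run o p (ℓ + e) ∷ post)
  longer-headʳ {n} rec {o = o} {p} {ℓ} rest post 1≤e ≤n ≤n′ ng ng′ tot sigs
    with trim-head rest post 1≤e ng ng′ tot sigs
  ... | inj₁ improved = inj₂ (inj₂ improved)
  ... | inj₂ (post″ , ng″ , len≡ , tot″ , sigs″) =
    Outcome-respʳ tot″ (cong suc len≡)
      (same-head rec (run o p ℓ) rest post″ ≤n (subst (_≤ n) (sym len≡) ≤n′) ng ng″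
        (trans tot (sym tot″)) (λ i → trans (sigs i) (sym (sigs″ i))))

  longer-headˡ : ∀ {n} → SigInjective n → ∀ {b u v o p ℓ e} rest post → 1 ≤ e →
    length rest ≤ n → length post ≤ n →
    NormalGeodesic b (run o p (ℓ + e) ∷ rest) u → NormalGeodesic b (run o p ℓ ∷ post) v →
    total (run o p (ℓ + e) ∷ rest) ≡ total (run o p ℓ ∷ post) →
    sig (run o p (ℓ + e) ∷ rest) ≗ sig (run o p ℓ ∷ post) →
    Outcome b u (run o p (ℓ + e) ∷ rest) v (run o p ℓ ∷ post)
  longer-headˡ {n} rec {o = o} {p} {ℓ} rest post 1≤e ≤n ≤n′ ng ng′ tot sigs
    with trim-head post rest 1≤e ng′ ng (sym tot) (λ i → sym (sigs i))
  ... | inj₁ improved = inj₂ (inj₁ improved)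
  ... | inj₂ (rest″ , ng″ , len≡ , tot″ , sigs″) =
    Outcome-respˡ tot″ (cong suc len≡)
      (same-head rec (run o p ℓ) rest″ post (subst (_≤ n) (sym len≡) ≤n) ≤n′ ng″ ng′
        (trans tot″ tot) (λ i → trans (sigs″ i) (sigs i)))

  same-track : ∀ {n} → SigInjective n → ∀ {b u v o p ℓ} rest pre {p′ ℓ′} post →
    length rest ≤ n → length (pre ++ run o p′ ℓ′ ∷ post) ≤ suc n →
    NormalGeodesic b (run o p ℓ ∷ rest) u → NormalGeodesic b (pre ++ run o p′ ℓ′ ∷ post) v →
    total (run o p ℓ ∷ rest) ≡ total (pre ++ run o p′ ℓ′ ∷ post) →
    sig (run o p ℓ ∷ rest) ≗ sig (pre ++ run o p′ ℓ′ ∷ post) →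
    Outcome b u (run o p ℓ ∷ rest) v (pre ++ run o p′ ℓ′ ∷ post)
  same-track rec {p = p} rest (r ∷ pre) post _ _ (geodesic (_ , ℓ≤ , pt≡ , _) _ , _) (geo′ , _) _ _ =
    inj₂ (inj₂ (merge-better r pre post pt≡ (m+n≤o⇒m≤o p ℓ≤) geo′))
  same-track rec {o = o} {p} {ℓ} rest [] {ℓ′ = ℓ′} post ≤n (s≤s ≤n′)
    ng@(geodesic (_ , ℓ≤ , pt≡ , _) _ , _) ng′ tot sigs
    with refl ← trans (aligned pt≡ (m+n≤o⇒m≤o p ℓ≤) [] post (proj₁ ng′)) (+-identityʳ p)
    with <-cmp ℓ ℓ′
  ... | tri≈ _ refl _ = same-head rec (run o p ℓ) rest post ≤n ≤n′ ng ng′ tot sigs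
  ... | tri< ℓ<ℓ′ _ _ with e , refl ← m≤n⇒∃[o]m+o≡n (<⇒≤ ℓ<ℓ′)
    = longer-headʳ rec rest post (m<m+n⇒0<n ℓ<ℓ′) ≤n ≤n′ ng ng′ tot sigs
  ... | tri> _ _ ℓ′<ℓ with e , refl ← m≤n⇒∃[o]m+o≡n (<⇒≤ ℓ′<ℓ)
    = longer-headˡ rec rest post (m<m+n⇒0<n ℓ′<ℓ) ≤n ≤n′ ng ng′ tot sigs

  sig-injective : ∀ n → SigInjective n
  sig-injective _ [] [] _ _ (geodesic refl _ , _) (geodesic refl _ , _) _ _ = inj₁ refl
  sig-injective _ [] (r ∷ rs′) _ _ _ _ _ sigs =
    contradiction (trans (sigs (proj₁ (track r))) (use-here (track r) (sig rs′))) λ ()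
  sig-injective _ (r ∷ rs) [] _ _ _ _ _ sigs =
    contradiction (trans (sym (sigs (proj₁ (track r)))) (use-here (track r) (sig rs))) λ ()
  sig-injective zero (_ ∷ _) (_ ∷ _) ()
  sig-injective (suc n) (run o p ℓ ∷ rest) rs′ (s≤s ≤n) ≤n′ ng ng′ tot sigs
    with pre , p′ , ℓ′ , post , refl ← locate rs′ (trans (sym (sigs (proj₁ o))) (use-here o _))
    = same-track (sig-injective n) rest pre post ≤n ≤n′ ng ng′ tot sigs

  edge-run : CoveredBy G P → ∀ {x y} → Graph.Adj G x y →
             Σ Track λ o → Σ ℕ λ p → p + 1 ≤ len o × pt o p ≡ x × pt o (p + 1) ≡ y
  edge-run cov {x} {y} e with cov x y e
  ... | i , on with edge-index (ShortestPath.walk (P i)) on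
  ...   | t , t+1≤ , inj₁ (t≡x , t+1≡y) = (i , true) , t , t+1≤ , t≡x , t+1≡y
  ...   | t , t+1≤ , inj₂ (t≡y , t+1≡x) =
    (i , false) , len (i , true) ∸ (t + 1) , ≤-trans (≤-reflexive (∸-shift t 1 t+1≤)) (m∸n≤m _ t) ,
    trans (reverseLine-pt ℒ t+1≤) t+1≡x ,
    trans (cong (pt (i , false)) (∸-shift t 1 t+1≤)) (trans (reverseLine-pt ℒ (m+n≤o⇒m≤o t t+1≤)) t≡y)
    where ℒ = pathLine (P i)

  decompose : CoveredBy G P → ∀ {b v m} → Walk G b v m → Σ (List Run) λ rs → Valid b rs v × total rs ≡ m
  decompose cov [ v ] = [] , refl , refl
  decompose cov (e ∷ w)
    with o , p , p+1≤ , px , py ← edge-run cov e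
    with rs , valid , tot ← decompose cov w
    = run o p 1 ∷ rs , (s≤s z≤n , p+1≤ , px , subst (λ z → Valid z rs _) (sym py) valid) , cong suc tot

  sig-collision : ∀ {b u v} rs rs′ → Geodesic b rs u → Geodesic b rs′ v →
                  total rs ≡ total rs′ → sig rs ≗ sig rs′ → Outcome b u rs v rs′
  sig-collision rs rs′ geo geo′ tot sigs with normalise rs geo | normalise rs′ geo′
  ... | inj₂ improved | _             = inj₂ (inj₁ improved)
  ... | inj₁ _        | inj₂ improved = inj₂ (inj₂ improved)
  ... | inj₁ normal   | inj₁ normal′  =
    sig-injective (length rs + length rs′) rs rs′ (m≤m+n _ _) (m≤n+m _ _)
      (geo , normal) (geo′ , normal′) tot sigs

module Counting (G : Graph) {k : ℕ} (P : Fin k → ShortestPath G) (cov : CoveredBy G P)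
                (a : Vertex G) (D : ℕ) (S : List (Vertex G)) (unique : Unique S)
                (dists : All (λ v → Dist G a v D) S) where
  open Walks G
  open Runs G P

  N : ℕ
  N = length S

  vertex : Fin N → Vertex G
  vertex = lookup S

  dist : ∀ i → Dist G a (vertex i) D
  dist i = All.lookup dists (∈-lookup i)

  record Entry (v : Vertex G) : Set where
    constructor entry
    field
      runs   : List Run
      valid  : Valid a runs v
      total≡ : total runs ≡ D
  open Entry

  Table : Set
  Table = (i : Fin N) → Entry (vertex i)

  weight : Table → ℕ
  weight T = ∑[ i < N ] length (runs (T i))

  geodesic-at : (T : Table) (i : Fin N) → Geodesic a (runs (T i)) (vertex i)
  geodesic-at T i = geodesic (valid (T i)) (subst (Dist≥ a (vertex i)) (sym (total≡ (T i))) (proj₂ (dist i)))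

  improve : (T : Table) (i : Fin N) → Better a (vertex i) (runs (T i)) → Σ Table λ T′ → weight T′ < weight T
  improve T i (better rs valid tot shorter) =
    T′ , ∑-< (λ j → length (runs (T′ j))) (λ j → length (runs (T j))) i same changed
    where
    T′ : Table
    T′ j with j ≟ i
    ... | yes refl = entry rs valid (trans tot (total≡ (T i)))
    ... | no  _    = T j
    same : ∀ j → j ≢ i → length (runs (T′ j)) ≡ length (runs (T j))
    same j j≢i with j ≟ i
    ... | yes j≡i = contradiction j≡i j≢i
    ... | no  _   = refl
    changed : length (runs (T′ i)) < length (runs (T i))
    changed with i ≟ i
    ... | yes refl = shorter
    ... | no  i≢i  = contradiction refl i≢i

  improvable : (T : Table) → 3 ^ k < N → Σ (Fin N) λ i → Better a (vertex i) (runs (T i))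
  improvable T 3ᵏ<N with pigeonhole 3ᵏ<N (code ∘ sig ∘ runs ∘ T)
  ... | i , j , i<j , same
    with sig-collision (runs (T i)) (runs (T j)) (geodesic-at T i) (geodesic-at T j)
                 (trans (total≡ (T i)) (sym (total≡ (T j)))) (code-injective _ _ same)
  ...   | inj₁ vᵢ≡vⱼ           = contradiction (lookup-injective unique vᵢ≡vⱼ) (Finₚ.<⇒≢ i<j)
  ...   | inj₂ (inj₁ improved) = i , improved
  ...   | inj₂ (inj₂ improved) = j , improved

  bounded : (T : Table) → Acc _<_ (weight T) → N ≤ 3 ^ k
  bounded T (acc lighter) with N ≤? 3 ^ k
  ... | yes N≤3ᵏ = N≤3ᵏ
  ... | no  N≰3ᵏ
    with i , improved ← improvable T (≰⇒> N≰3ᵏ)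
    with T′ , T′<T ← improve T i improved
    = bounded T′ (lighter T′<T)

  initial : Table
  initial i with rs , valid , tot ← decompose cov (proj₁ (dist i)) = entry rs valid tot

  count : N ≤ 3 ^ k
  count = bounded initial (<-wellFounded _)

lemma12 : Σ ℕ λ C → C > 0 ×
    ((k : ℕ) → k ≥ 1 →
      (G : Graph) → Connected G →
      (P : Fin k → ShortestPath G) → CoveredBy G P →
      (a : Vertex G) (D : ℕ) →
      (S : List (Vertex G)) → Unique S → All (λ v → Dist G a v D) S →
      length S ≤ C * 3 ^ k)
lemma12 = 1 , s≤s z≤n , λ k _ G _ P cov a D S unique dists →
  subst (length S ≤_) (sym (*-identityˡ (3 ^ k))) (Counting.count G P cov a D S unique dists)
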